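{- Let $\mathcal{B}$ be an oplax covariant lens over a reflexive graph $\mathcal{A}$. If each $\mathcal{B}(x)$ is univalent, then the display $\mathsf{disp}^+_{\mathcal{A}}\mathcal{B}$ is a univalent displayed reflexive graph.
   Context: Intensional Martin-Löf type theory with $\Pi,\Sigma$, identity types. A reflexive graph $\mathcal{G}$: vertex type $|\mathcal{G}|$, edge types $x\approx_{\mathcal{G}}y$, $\mathsf{rx}_{\mathcal{G}}(x):x\approx_{\mathcal{G}}x$; univalent if each fan $\sum_{y}x\approx_{\mathcal{G}}y$ is a proposition. A displayed reflexive graph $\mathcal{D}$ over $\mathcal{A}$: types $|\mathcal{D}|(x)$, types $u\approx^{\mathcal{D}}_pv$ for $p:x\approx_{\mathcal{A}}y$, $u:|\mathcal{D}|(x)$, $v:|\mathcal{D}|(y)$, and $\mathsf{rx}^{\mathcal{D}}_x(u):u\approx^{\mathcal{D}}_{\mathsf{rx}_{\mathcal{A}}(x)}u$; its component $\mathcal{D}(x)$ has vertices $|\mathcal{D}|(x)$, edges $u\approx^{\mathcal{D}}_{\mathsf{rx}_{\mathcal{A}}(x)}v$, reflexivity $\mathsf{rx}^{\mathcal{D}}_x$; $\mathcal{D}$ is univalent if every component is univalent. An oplax covariant lens over $\mathcal{A}$: family of reflexive graphs $\mathcal{B}(x)$, $\mathsf{push}_p:|\mathcal{B}(x)|\to|\mathcal{B}(y)|$ for $p:x\approx_{\mathcal{A}}y$, and $\mathsf{pushRx}_x(u):\mathsf{push}_{\mathsf{rx}_{\mathcal{A}}(x)}u\approx_{\mathcal{B}(x)}u$.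 Its display $\mathsf{disp}^+_{\mathcal{A}}\mathcal{B}$ has vertices $|\mathcal{B}(x)|$, edges $u\approx_pv:=\mathsf{push}_pu\approx_{\mathcal{B}(y)}v$, and reflexivity $\mathsf{pushRx}_x(u)$. -}

{-# OPTIONS --without-K #-}
module Defs where

open import Level using (Level; _⊔_; suc)
open import Data.Product using (Σ; _,_)
open import Relation.Binary.PropositionalEquality using (_≡_)

isProp : ∀ {ℓ} → Set ℓ → Set ℓ
isProp A = (a b : A) → a ≡ b

record RGraph (ℓ₀ ℓ₁ : Level) : Set (suc (ℓ₀ ⊔ ℓ₁)) where
  field
    Vtx : Set ℓ₀
    _≈_ : Vtx → Vtx → Set ℓ₁
    rx  : (x : Vtx) → x ≈ x
open RGraph public

isUnivalent : ∀ {ℓ₀ ℓ₁} → RGraph ℓ₀ ℓ₁ → Set (ℓ₀ ⊔ ℓ₁)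
isUnivalent G = (x : Vtx G) → isProp (Σ (Vtx G) (λ y → _≈_ G x y))

record DispRGraph {ℓ₀ ℓ₁ : Level} (A : RGraph ℓ₀ ℓ₁) (ℓ₂ ℓ₃ : Level)
    : Set (ℓ₀ ⊔ ℓ₁ ⊔ suc (ℓ₂ ⊔ ℓ₃)) where
  field
    DVtx : Vtx A → Set ℓ₂
    DEdge : {x y : Vtx A} → _≈_ A x y → DVtx x → DVtx y → Set ℓ₃
    drx  : (x : Vtx A) (u : DVtx x) → DEdge (rx A x) u u
open DispRGraph public

component : ∀ {ℓ₀ ℓ₁ ℓ₂ ℓ₃} {A : RGraph ℓ₀ ℓ₁} → DispRGraph A ℓ₂ ℓ₃
  → Vtx A → RGraph ℓ₂ ℓ₃
component {A = A} D x = record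
  { Vtx = DVtx D x
  ; _≈_ = λ u v → DEdge D (rx A x) u v
  ; rx  = drx D x }

isUnivalentDisp : ∀ {ℓ₀ ℓ₁ ℓ₂ ℓ₃} {A : RGraph ℓ₀ ℓ₁} → DispRGraph A ℓ₂ ℓ₃
  → Set (ℓ₀ ⊔ ℓ₂ ⊔ ℓ₃)
isUnivalentDisp {A = A} D = (x : Vtx A) → isUnivalent (component D x)

record OplaxCovLens {ℓ₀ ℓ₁ : Level} (A : RGraph ℓ₀ ℓ₁) (ℓ₂ ℓ₃ : Level)
    : Set (ℓ₀ ⊔ ℓ₁ ⊔ suc (ℓ₂ ⊔ ℓ₃)) where
  field
    fam    : Vtx A → RGraph ℓ₂ ℓ₃
    push   : {x y : Vtx A} → _≈_ A x y → Vtx (fam x) → Vtx (fam y)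
    pushRx : (x : Vtx A) (u : Vtx (fam x)) → _≈_ (fam x) (push (rx A x) u) u
open OplaxCovLens public

disp⁺ : ∀ {ℓ₀ ℓ₁ ℓ₂ ℓ₃} {A : RGraph ℓ₀ ℓ₁} → OplaxCovLens A ℓ₂ ℓ₃
  → DispRGraph A ℓ₂ ℓ₃
disp⁺ {A = A} B = record
  { DVtx  = λ x → Vtx (fam B x)
  ; DEdge = λ {x} {y} p u v → _≈_ (fam B y) (push B p u) v
  ; drx   = pushRx B }

{-# OPTIONS --without-K #-}
module Submission where

open import Defs

-- The fan of the component at u is, definitionally, the fan of B(x) at
-- push (rx x) u.
mainTheorem4 : ∀ {ℓ₀ ℓ₁ ℓ₂ ℓ₃} (A : RGraph ℓ₀ ℓ₁) (B : OplaxCovLens A ℓ₂ ℓ₃)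
    → ((x : Vtx A) → isUnivalent (fam B x))
    → isUnivalentDisp (disp⁺ B)
mainTheorem4 A B univalent-fam x u = univalent-fam x (push B (rx A x) u)
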